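{- Let $X\subseteq\{0,1\}^n$ and $A\in\{0,1\}^{K\times n}$ with $Ax\in\{0,1\}^K$ for all $x\in X$. Let $x^*\in X$ and $\nu^*:=Ax^*$. Let $\Delta\in\mathbb{R}^K$ satisfy $\Delta(s)\ge0$ whenever $\nu^*(s)=1$ and $\Delta(s)\le0$ whenever $\nu^*(s)=0$. Then (i) $x^*\in\arg\min_{x\in X}\langle-\Delta,Ax\rangle$, and (ii) for every $x^{**}\in\arg\min_{x\in X}\langle-\Delta,Ax\rangle$, with $\nu^{**}:=Ax^{**}$, it holds that $\Delta(s)=0$ for every $s$ with $\nu^*(s)\neq\nu^{**}(s)$. -}

module Defs where

open import Level using (Level; suc; _⊔_)
open import Data.Nat as ℕ using (ℕ; zero) renaming (suc to 1+)
open import Data.Bool using (Bool; true; false)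
open import Data.Fin using (Fin) renaming (zero to fz; suc to fs)
open import Data.Product using (_×_)
open import Algebra.Bundles using (CommutativeRing)
open import Relation.Binary.Structures using (IsTotalOrder)

-- An ordered commutative ring (the reals are an instance): a commutative
-- ring with a total order compatible with + and *.
record OrderedCommutativeRing (c ℓ₁ ℓ₂ : Level) : Set (suc (c ⊔ ℓ₁ ⊔ ℓ₂)) where
  field
    commutativeRing : CommutativeRing c ℓ₁
  open CommutativeRing commutativeRing public
  field
    _≤_         : Carrier → Carrier → Set ℓ₂
    isTotalOrder : IsTotalOrder _≈_ _≤_
    +-mono-≤    : ∀ {x y} z → x ≤ y → (x + z) ≤ (y + z)
    *-nonneg    : ∀ {x y} → 0# ≤ x → 0# ≤ y → 0# ≤ (x * y)

bit : Bool → ℕ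
bit false = 0
bit true  = 1

∑ℕ : ∀ {n} → (Fin n → ℕ) → ℕ
∑ℕ {zero}  f = 0
∑ℕ {1+ n} f = f fz ℕ.+ ∑ℕ (λ i → f (fs i))

mulVec : ∀ {K n} → (Fin K → Fin n → Bool) → (Fin n → Bool) → Fin K → ℕ
mulVec A x s = ∑ℕ (λ j → bit (A s j) ℕ.* bit (x j))

module _ {c ℓ₁ ℓ₂} (R : OrderedCommutativeRing c ℓ₁ ℓ₂) where
  open OrderedCommutativeRing R

  ι : ℕ → Carrier
  ι zero   = 0#
  ι (1+ m) = 1# + ι m

  ∑ : ∀ {n} → (Fin n → Carrier) → Carrier
  ∑ {zero}  f = 0#
  ∑ {1+ n} f = f fz + ∑ (λ i → f (fs i))

  ⟨_,_⟩ : ∀ {K} → (Fin K → Carrier) → (Fin K → ℕ) → Carrier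
  ⟨ u , v ⟩ = ∑ (λ s → u s * ι (v s))

  IsArgMin : ∀ {a} {B : Set a} {p} → (B → Set p) → (B → Carrier) → B → Set (a ⊔ p ⊔ ℓ₂)
  IsArgMin X f x = X x × (∀ y → X y → f x ≤ f y)

-- The objective ⟨−Δ, Ax⟩ = ∑ₛ −Δ(s)·(Ax)(s) is separable over s, and every summand has a
-- 0/1 argument. The sign conditions on Δ say that ν*(s) minimises −Δ(s)·t over t ∈ {0,1}
-- for each s separately, so x* minimises the sum. If x** is another minimiser, its
-- summands dominate those of x* while their sums agree, hence they agree summand by
-- summand; where ν*(s) ≠ ν**(s) this equality reads −Δ(s) = 0.
module Submission where

open import Defs
open import Data.Nat using (ℕ; zero; suc; _≤_; s≤s)
open import Data.Bool using (Bool)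
open import Data.Fin using (Fin) renaming (zero to fz; suc to fs)
open import Data.Product using (_×_; _,_; proj₁)
open import Data.Empty using (⊥-elim)
open import Relation.Binary.PropositionalEquality using (_≡_; _≢_; refl)
open import Relation.Binary.Bundles using (Poset)
open import Relation.Binary.Structures using (IsTotalOrder)
import Algebra.Properties.Ring as RingProperties
import Relation.Binary.Reasoning.PartialOrder as PosetReasoning

module OrderedRingProperties {c ℓ₁ ℓ₂} (R : OrderedCommutativeRing c ℓ₁ ℓ₂) where
  open OrderedCommutativeRing R hiding (refl) renaming (_≤_ to infix 4 _≤R_)
  open IsTotalOrder isTotalOrder using (antisym) renaming (refl to ≤R-refl; trans to ≤R-trans)
  open RingProperties ring using (-‿injective; -0#≈0#)

  poset : Poset c ℓ₁ ℓ₂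
  poset = record { isPartialOrder = IsTotalOrder.isPartialOrder isTotalOrder }

  open PosetReasoning poset

  +-monoʳ-≤ : ∀ z {x y} → x ≤R y → z + x ≤R z + y
  +-monoʳ-≤ z {x} {y} x≤y = begin
    z + x  ≈⟨ +-comm z x ⟩
    x + z  ≤⟨ +-mono-≤ z x≤y ⟩
    y + z  ≈⟨ +-comm y z ⟩
    z + y  ∎

  +-mono₂-≤ : ∀ {x y u v} → x ≤R y → u ≤R v → x + u ≤R y + v
  +-mono₂-≤ {x} {y} {u} {v} x≤y u≤v = begin
    x + u  ≤⟨ +-mono-≤ u x≤y ⟩
    y + u  ≤⟨ +-monoʳ-≤ y u≤v ⟩
    y + v  ∎

  +-cancelʳ-≤ : ∀ z {x y} → x + z ≤R y + z → x ≤R y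
  +-cancelʳ-≤ z {x} {y} x+z≤y+z = begin
    x              ≈⟨ sym (x+z-z≈x x) ⟩
    x + z + - z    ≤⟨ +-mono-≤ (- z) x+z≤y+z ⟩
    y + z + - z    ≈⟨ x+z-z≈x y ⟩
    y              ∎
    where
    x+z-z≈x : ∀ w → w + z + - z ≈ w
    x+z-z≈x w = trans (+-assoc w z (- z)) (trans (+-congˡ (-‿inverseʳ z)) (+-identityʳ w))

  +-cancelˡ-≤ : ∀ z {x y} → z + x ≤R z + y → x ≤R y
  +-cancelˡ-≤ z {x} {y} z+x≤z+y = +-cancelʳ-≤ z (begin
    x + z  ≈⟨ +-comm x z ⟩
    z + x  ≤⟨ z+x≤z+y ⟩
    z + y  ≈⟨ +-comm z y ⟩
    y + z  ∎)

  0≤x⇒-x≤0 : ∀ {x} → 0# ≤R x → - x ≤R 0#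
  0≤x⇒-x≤0 {x} 0≤x = begin
    - x       ≈⟨ sym (+-identityˡ (- x)) ⟩
    0# + - x  ≤⟨ +-mono-≤ (- x) 0≤x ⟩
    x + - x   ≈⟨ -‿inverseʳ x ⟩
    0#        ∎

  x≤0⇒0≤-x : ∀ {x} → x ≤R 0# → 0# ≤R - x
  x≤0⇒0≤-x {x} x≤0 = begin
    0#        ≈⟨ sym (-‿inverseʳ x) ⟩
    x + - x   ≤⟨ +-mono-≤ (- x) x≤0 ⟩
    0# + - x  ≈⟨ +-identityˡ (- x) ⟩
    - x       ∎

  -x≈0⇒x≈0 : ∀ {x} → - x ≈ 0# → x ≈ 0#
  -x≈0⇒x≈0 -x≈0 = -‿injective (trans -x≈0 (sym -0#≈0#))

  ∑-mono-≤ : ∀ {K} (a b : Fin K → Carrier) → (∀ s → a s ≤R b s) → ∑ R a ≤R ∑ R b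
  ∑-mono-≤ {zero}   a b a≤b = ≤R-refl
  ∑-mono-≤ {suc K} a b a≤b =
    +-mono₂-≤ (a≤b fz) (∑-mono-≤ (λ s → a (fs s)) (λ s → b (fs s)) (λ s → a≤b (fs s)))

  ∑-mono-≤-tight : ∀ {K} (a b : Fin K → Carrier) → (∀ s → a s ≤R b s) →
                   ∑ R b ≤R ∑ R a → ∀ s → b s ≤R a s
  ∑-mono-≤-tight a b a≤b ∑b≤∑a fz = +-cancelʳ-≤ _ (begin
    b fz + ∑ R (λ s → a (fs s))  ≤⟨ +-monoʳ-≤ (b fz) (∑-mono-≤ _ _ (λ s → a≤b (fs s))) ⟩
    b fz + ∑ R (λ s → b (fs s))  ≤⟨ ∑b≤∑a ⟩
    a fz + ∑ R (λ s → a (fs s))  ∎)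
  ∑-mono-≤-tight a b a≤b ∑b≤∑a (fs s) =
    ∑-mono-≤-tight (λ s → a (fs s)) (λ s → b (fs s)) (λ s → a≤b (fs s))
      (+-cancelˡ-≤ (a fz) (≤R-trans (+-mono-≤ _ (a≤b fz)) ∑b≤∑a)) s

  pointwise-minimal⇒argmin-∑ : ∀ {b p K} {B : Set b} {X : B → Set p} (f : B → Fin K → Carrier) {x} →
                               X x → (∀ y → X y → ∀ s → f x s ≤R f y s) →
                               IsArgMin R X (λ y → ∑ R (f y)) x
  pointwise-minimal⇒argmin-∑ f Xx minimal = Xx , λ y Xy → ∑-mono-≤ (f _) (f y) (minimal y Xy)

  pointwise-minimal⇒argmin-∑⇒≈ : ∀ {b p K} {B : Set b} {X : B → Set p} (f : B → Fin K → Carrier) {x x′} →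
                                 X x → (∀ y → X y → ∀ s → f x s ≤R f y s) →
                                 IsArgMin R X (λ y → ∑ R (f y)) x′ → ∀ s → f x s ≈ f x′ s
  pointwise-minimal⇒argmin-∑⇒≈ f Xx minimal (Xx′ , x′-minimal) s =
    antisym (minimal _ Xx′ s) (∑-mono-≤-tight (f _) (f _) (minimal _ Xx′) (x′-minimal _ Xx) s)

  u*ι1≈u : ∀ u → u * ι R 1 ≈ u
  u*ι1≈u u = trans (*-congˡ (+-identityʳ 1#)) (*-identityʳ u)

  -d*ι-minimal : ∀ d {m k} → m ≤ 1 → k ≤ 1 → (m ≡ 1 → 0# ≤R d) → (m ≡ 0 → d ≤R 0#) →
                 - d * ι R m ≤R - d * ι R k
  -d*ι-minimal d {0} {0} _ _ _ _ = ≤R-refl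
  -d*ι-minimal d {1} {1} _ _ _ _ = ≤R-refl
  -d*ι-minimal d {0} {1} _ _ _ d≤0 = begin
    - d * 0#      ≈⟨ zeroʳ (- d) ⟩
    0#            ≤⟨ x≤0⇒0≤-x (d≤0 refl) ⟩
    - d           ≈⟨ sym (u*ι1≈u (- d)) ⟩
    - d * ι R 1   ∎
  -d*ι-minimal d {1} {0} _ _ 0≤d _ = begin
    - d * ι R 1   ≈⟨ u*ι1≈u (- d) ⟩
    - d           ≤⟨ 0≤x⇒-x≤0 (0≤d refl) ⟩
    0#            ≈⟨ sym (zeroʳ (- d)) ⟩
    - d * 0#      ∎
  -d*ι-minimal d {suc (suc _)} (s≤s ()) _ _ _
  -d*ι-minimal d {_} {suc (suc _)} _ (s≤s ()) _ _

  -d*ι-tight : ∀ d {m k} → m ≤ 1 → k ≤ 1 → m ≢ k → - d * ι R m ≈ - d * ι R k → d ≈ 0#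
  -d*ι-tight d {0} {0} _ _ m≢k _ = ⊥-elim (m≢k refl)
  -d*ι-tight d {1} {1} _ _ m≢k _ = ⊥-elim (m≢k refl)
  -d*ι-tight d {0} {1} _ _ _ eq = -x≈0⇒x≈0 (trans (sym (u*ι1≈u (- d))) (trans (sym eq) (zeroʳ (- d))))
  -d*ι-tight d {1} {0} _ _ _ eq = -x≈0⇒x≈0 (trans (sym (u*ι1≈u (- d))) (trans eq (zeroʳ (- d))))
  -d*ι-tight d {suc (suc _)} (s≤s ()) _ _ _
  -d*ι-tight d {_} {suc (suc _)} _ (s≤s ()) _ _

lemma3 : ∀ {c ℓ₁ ℓ₂ p} (R : OrderedCommutativeRing c ℓ₁ ℓ₂) →
         let open OrderedCommutativeRing R renaming (_≤_ to _≤R_) in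
         (n K : ℕ) (X : (Fin n → Bool) → Set p) (A : Fin K → Fin n → Bool) →
         (∀ x → X x → ∀ s → mulVec A x s ≤ 1) →
         (x* : Fin n → Bool) → X x* →
         (Δ : Fin K → Carrier) →
         (∀ s → mulVec A x* s ≡ 1 → 0# ≤R Δ s) →
         (∀ s → mulVec A x* s ≡ 0 → Δ s ≤R 0#) →
         IsArgMin R X (λ x → ⟨_,_⟩ R (λ s → - Δ s) (mulVec A x)) x*
         × (∀ x** → IsArgMin R X (λ x → ⟨_,_⟩ R (λ s → - Δ s) (mulVec A x)) x** →
              ∀ s → mulVec A x* s ≢ mulVec A x** s → Δ s ≈ 0#)
lemma3 R n K X A Ax≤1 x* Xx* Δ Δ≥0 Δ≤0 =
  pointwise-minimal⇒argmin-∑ summand Xx* x*-minimal ,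
  λ x** x**-argmin s ν*≢ν** →
    -d*ι-tight (Δ s) (Ax≤1 x* Xx* s) (Ax≤1 x** (proj₁ x**-argmin) s) ν*≢ν**
      (pointwise-minimal⇒argmin-∑⇒≈ summand Xx* x*-minimal x**-argmin s)
  where
  open OrderedCommutativeRing R using (Carrier; -_; _*_) renaming (_≤_ to _≤R_)
  open OrderedRingProperties R

  summand : (Fin n → Bool) → Fin K → Carrier
  summand x s = - Δ s * ι R (mulVec A x s)

  x*-minimal : ∀ y → X y → ∀ s → summand x* s ≤R summand y s
  x*-minimal y Xy s = -d*ι-minimal (Δ s) (Ax≤1 x* Xx* s) (Ax≤1 y Xy s) (Δ≥0 s) (Δ≤0 s)
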